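{- Every integral solution $(x,y)\in\mathbb Z^2$ of $X^2-\Delta Y^2=4$ gives rise to an integral solution of one of the equations $\mathcal T_a: ar^2-bs^2=4$, where $a,b$ are integers with $ab=\Delta$ and $a$ is squarefree; namely there are such $a,b$ and integers $r,s$ with $ar^2-bs^2=4$, $x=ar^2-2$ and $y=rs$. Conversely, for any integers $a,b$ with $ab=\Delta$, any integral solution $(r,s)$ of $ar^2-bs^2=4$ gives an integral solution $(x,y)=(ar^2-2,\,rs)$ of $X^2-\Delta Y^2=4$.
   Context: Let $d$ be a squarefree integer with $d\neq 1$, and put $\Delta=d$ if $d\equiv 1\pmod 4$ and $\Delta=4d$ if $d\equiv 2,3\pmod 4$. -}

module Defs where

open import Data.Nat as ℕ using (ℕ)
open import Data.Integer using (ℤ; _*_; ∣_∣; +_)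
open import Data.Integer.Divisibility using (_∣_)
open import Data.Integer.DivMod using (_%ℕ_)
open import Relation.Binary.PropositionalEquality using (_≡_)

-- An integer m is squarefree if the only integers n with n² ∣ m are ±1.
-- (So 0 is not squarefree; ±1 are.)
SquareFree : ℤ → Set
SquareFree m = ∀ (n : ℤ) → (n * n) ∣ m → ∣ n ∣ ≡ 1

disc : ℤ → ℤ
disc d with d %ℕ 4
... | 1 = d
... | _ = + 4 * d

{-# OPTIONS --safe #-}
module Submission where

-- (x + 2)(x − 2) = Δ y².  If m n = D y² with m and n coprime, then r = gcd(m, y) and
-- s = gcd(n, y) satisfy y = r s, r² ∣ m and s² ∣ n, so m = a r² and n = b s² with a b = D.
-- Once the powers of 2 shared by x + 2 and x − 2 are removed, this applies to the coprime pairs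
--   x + 2, x − 2          when x is odd,
--   P + 1, P              when x = 4P + 2  (then x ± 2 = 4(P + 1), 4P),
--   2U + 1, 2U − 1        when x = 4U and Δ = 4d,
-- and a is squarefree because it divides d (in the last case a is twice an odd divisor of d).
-- The remaining residues of x are impossible modulo 16, and y = 0 forces x = ±2.

module Natural where
  open import Data.Nat.Base using (ℕ; _*_)
  open import Data.Nat.Properties using (*-comm)
  open import Data.Nat.Divisibility
  open import Data.Nat.GCD using (gcd; gcd[m,n]∣m; gcd[m,n]∣n; gcd-greatest; c*gcd[m,n]≡gcd[cm,cn])
  open import Data.Nat.Coprimality using (Coprime; coprime-divisor) renaming (sym to coprime-sym)
  open import Data.Product.Base using (_×_; _,_)
  open import Relation.Binary.PropositionalEquality using (_≡_; refl; sym; trans; subst)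

  private variable a b d e m n r s y : ℕ

  coprime-∣ : d ∣ m → e ∣ n → Coprime m n → Coprime d e
  coprime-∣ d∣m e∣n c (g∣d , g∣e) = c (∣-trans g∣d d∣m , ∣-trans g∣e e∣n)

  coprime-*ˡ : Coprime a n → Coprime b n → Coprime (a * b) n
  coprime-*ˡ {a} a⊥n b⊥n {g} (g∣ab , g∣n) = b⊥n (coprime-divisor g⊥a g∣ab , g∣n)
    where
    g⊥a : Coprime g a
    g⊥a (h∣g , h∣a) = a⊥n (h∣a , ∣-trans h∣g g∣n)

  coprime-*-∣ : Coprime r s → r ∣ y → s ∣ y → r * s ∣ y
  coprime-*-∣ {r} {s} r⊥s (divides q refl) s∣qr =
    subst (r * s ∣_) (*-comm r q)
      (*-monoʳ-∣ r (coprime-divisor (coprime-sym r⊥s) (subst (s ∣_) (*-comm q r) s∣qr)))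

  -- gcd m y * gcd n y ≡ gcd (gcd m y * n) (gcd m y * y), and y divides both arguments.
  ∣*⇒∣gcd*gcd : y ∣ m * n → y ∣ gcd m y * gcd n y
  ∣*⇒∣gcd*gcd {y} {m} {n} y∣mn =
    subst (y ∣_) (sym (c*gcd[m,n]≡gcd[cm,cn] g n y)) (gcd-greatest y∣g*n (n∣m*n g))
    where
    g = gcd m y
    y∣g*n : y ∣ g * n
    y∣g*n = subst (y ∣_) (trans (sym (c*gcd[m,n]≡gcd[cm,cn] n m y)) (*-comm n g))
                  (gcd-greatest (subst (y ∣_) (*-comm m n) y∣mn) (n∣m*n n))

  gcd²∣ : Coprime m n → y * y ∣ m * n → gcd m y * gcd m y ∣ m
  gcd²∣ {m} {n} {y} m⊥n y²∣mn =
    coprime-divisor (coprime-*ˡ g⊥n g⊥n) (subst (g * g ∣_) (*-comm m n) g²∣mn)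
    where
    g = gcd m y
    g⊥n : Coprime g n
    g⊥n = coprime-∣ (gcd[m,n]∣m m y) ∣-refl m⊥n
    g²∣mn : g * g ∣ m * n
    g²∣mn = ∣-trans (*-pres-∣ (gcd[m,n]∣n m y) (gcd[m,n]∣n m y)) y²∣mn

  coprime-square-split : Coprime m n → y * y ∣ m * n →
    gcd m y * gcd m y ∣ m × gcd n y * gcd n y ∣ n × y ≡ gcd m y * gcd n y
  coprime-square-split {m} {n} {y} m⊥n y²∣mn =
    gcd²∣ m⊥n y²∣mn ,
    gcd²∣ (coprime-sym m⊥n) (subst (y * y ∣_) (*-comm m n) y²∣mn) ,
    ∣-antisym (∣*⇒∣gcd*gcd {m = m} (∣-trans (m∣m*n y) y²∣mn))
              (coprime-*-∣ (coprime-∣ (gcd[m,n]∣m m y) (gcd[m,n]∣m n y) m⊥n)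
                           (gcd[m,n]∣n m y) (gcd[m,n]∣n n y))

open import Defs
open import Data.Integer using (ℤ; _+_; _-_; _*_; +_)
open import Data.Product using (_×_; ∃-syntax)
open import Relation.Binary.PropositionalEquality using (_≡_; _≢_)

open import Data.Integer.Base using (-_; ∣_∣; 0ℤ; ≢-nonZero)
open import Data.Integer.Properties
  using (_≟_; abs-*; pos-*; ∣-i∣≡∣i∣; +∣i∣≡i⊎+∣i∣≡-i; neg-involutive; neg-distribʳ-*;
         *-identityˡ; +-identityˡ; *-assoc; +-comm; *-comm; *-cancelˡ-≡; *-cancelʳ-≡; i*j≢0)
open import Data.Integer.Divisibility using (_∣_) renaming (*-cancelˡ-∣ to ∣-*-cancelˡ)
import Data.Integer.Divisibility.Signed as Signed
open import Data.Integer.Coprimality using (Coprime; coprime-divisor)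
open import Data.Integer.DivMod using (_%ℕ_; _/ℕ_; n%ℕd<d; a≡a%ℕn+[a/ℕn]*n)
open import Data.Integer.Tactic.RingSolver using (solve)
import Data.Nat.Base as ℕ
import Data.Nat.Properties as ℕ
import Data.Nat.Divisibility as ℕ
import Data.Nat.DivMod as ℕ
open import Data.Nat.GCD using (gcd)
open import Data.List.Base using (_∷_; [])
open import Data.Product.Base using (_,_)
open import Data.Sum.Base using (_⊎_; inj₁; inj₂)
open import Data.Empty using (⊥-elim)
open import Relation.Nullary using (¬_; yes; no; contradiction)
open import Relation.Binary.PropositionalEquality using (refl; sym; trans; cong; cong₂; subst; module ≡-Reasoning)
open ≡-Reasoning

private variable a b c d k m n t x y D P U Δ : ℤ

data Parity (z : ℤ) : Set where
  even : ∀ k → z ≡ + 2 * k → Parity z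
  odd  : ∀ k → z ≡ + 2 * k + + 1 → Parity z

parity : ∀ z → Parity z
parity z with z %ℕ 2 | z /ℕ 2 | n%ℕd<d z 2 | a≡a%ℕn+[a/ℕn]*n z 2
... | 0 | q | _ | z≡ = even q (trans z≡ (trans (+-identityˡ (q * + 2)) (*-comm q (+ 2))))
... | 1 | q | _ | z≡ = odd q (trans z≡ (trans (+-comm (+ 1) (q * + 2)) (cong (_+ + 1) (*-comm q (+ 2)))))
... | ℕ.suc (ℕ.suc _) | _ | ℕ.s≤s (ℕ.s≤s ()) | _

-- Phrased with c % k so that, for literal k and c, the side condition is proved by λ ().
k*t≢c : ∀ k {c} .{{_ : ℕ.NonZero k}} → c ℕ.% k ≢ 0 → ∀ t → + k * t ≢ + c
k*t≢c k c%k≢0 t kt≡c = c%k≢0 (subst (λ n → n ℕ.% k ≡ 0) ∣t∣k≡c (ℕ.m*n%n≡0 ∣ t ∣ k))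
  where ∣t∣k≡c = trans (ℕ.*-comm ∣ t ∣ k) (trans (sym (abs-* (+ k) t)) (cong ∣_∣ kt≡c))

2∤factor-of-odd : a * c ≡ + 2 * k + + 1 → ¬ (+ 2 ∣ a)
2∤factor-of-odd {a} {c} {k} ac≡2k+1 2∣a with Signed.∣ᵤ⇒∣ {+ 2} {a} 2∣a
... | Signed.divides q refl = k*t≢c 2 (λ ()) (q * c - k) (begin
  + 2 * (q * c - k)         ≡⟨ solve (q ∷ c ∷ k ∷ []) ⟩
  q * + 2 * c - + 2 * k     ≡⟨ cong (_- + 2 * k) ac≡2k+1 ⟩
  + 2 * k + + 1 - + 2 * k   ≡⟨ solve (k ∷ []) ⟩
  + 1                       ∎)

lincomb≡1⇒coprime : ∀ p u q v → p * u + q * v ≡ + 1 → Coprime u v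
lincomb≡1⇒coprime p u q v pu+qv≡1 {g} (g∣u , g∣v) =
  ℕ.∣1⇒≡1 (Signed.∣⇒∣ᵤ (subst (+ g Signed.∣_) pu+qv≡1
    (Signed.∣m∣n⇒∣m+n (Signed.∣n⇒∣m*n p (Signed.∣ᵤ⇒∣ {+ g} {u} g∣u))
                      (Signed.∣n⇒∣m*n q (Signed.∣ᵤ⇒∣ {+ g} {v} g∣v)))))

*-cancel-squares : ∀ a b r s → m ≡ a * (r * r) → n ≡ b * (s * s) → y ≡ r * s → y ≢ 0ℤ →
                   m * n ≡ D * (y * y) → a * b ≡ D
*-cancel-squares {D = D} a b r s refl refl refl rs≢0 mn≡Dy² =
  *-cancelʳ-≡ (a * b) D ((r * s) * (r * s)) {{i*j≢0 (r * s) (r * s) {{≢-nonZero rs≢0}} {{≢-nonZero rs≢0}}}}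
    (begin
      a * b * ((r * s) * (r * s))  ≡⟨ solve (a ∷ b ∷ r ∷ s ∷ []) ⟩
      a * (r * r) * (b * (s * s))  ≡⟨ mn≡Dy² ⟩
      D * ((r * s) * (r * s))      ∎)

∣y∣≡R*S⇒y≡R*s : ∀ R S → ∣ y ∣ ≡ R ℕ.* S → ∃[ s ] (y ≡ + R * s × s * s ≡ + S * + S)
∣y∣≡R*S⇒y≡R*s {y} R S ∣y∣≡RS with +∣i∣≡i⊎+∣i∣≡-i y
... | inj₁ +∣y∣≡y  = + S , trans (sym +∣y∣≡y) +∣y∣≡R*S , refl
  where
  +∣y∣≡R*S : + ∣ y ∣ ≡ + R * + S
  +∣y∣≡R*S = trans (cong +_ ∣y∣≡RS) (pos-* R S)
... | inj₂ +∣y∣≡-y = - + S , y≡R*-S , neg-square (+ S)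
  where
  y≡R*-S : y ≡ + R * - + S
  y≡R*-S = begin
    y              ≡⟨ sym (neg-involutive y) ⟩
    - - y          ≡⟨ cong -_ (sym +∣y∣≡-y) ⟩
    - + ∣ y ∣      ≡⟨ cong -_ (trans (cong +_ ∣y∣≡RS) (pos-* R S)) ⟩
    - (+ R * + S)  ≡⟨ neg-distribʳ-* (+ R) (+ S) ⟩
    + R * - + S    ∎
  neg-square : ∀ t → (- t) * (- t) ≡ t * t
  neg-square t = solve (t ∷ [])

square-quotient : ∀ R → R ℕ.* R ℕ.∣ ∣ m ∣ → ∃[ a ] m ≡ a * (+ R * + R)
square-quotient {m} R R²∣m = quotient , equality
  where
  open Signed._∣_ (Signed.∣ᵤ⇒∣ {+ R * + R} {m} (subst (ℕ._∣ ∣ m ∣) (sym (abs-* (+ R) (+ R))) R²∣m))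

SquareSplit : ℤ → ℤ → ℤ → ℤ → Set
SquareSplit D m n y = ∃[ a ] ∃[ b ] ∃[ r ] ∃[ s ]
  (m ≡ a * (r * r) × n ≡ b * (s * s) × y ≡ r * s × a * b ≡ D)

coprime-square-split : Coprime m n → m * n ≡ D * (y * y) → y ≢ 0ℤ → SquareSplit D m n y
coprime-square-split {m} {n} {D} {y} m⊥n mn≡Dy² y≢0 =
  let R²∣m , S²∣n , ∣y∣≡RS = Natural.coprime-square-split {∣ m ∣} {∣ n ∣} {∣ y ∣} m⊥n
                               (ℕ.divides ∣ D ∣ ∣mn∣≡∣D∣∣y∣²)
      a , m≡aR²            = square-quotient R R²∣m
      b , n≡bS²            = square-quotient S S²∣n
      s , y≡Rs , s²≡S²     = ∣y∣≡R*S⇒y≡R*s R S ∣y∣≡RS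
      n≡bs²                = trans n≡bS² (cong (b *_) (sym s²≡S²))
  in a , b , + R , s , m≡aR² , n≡bs² , y≡Rs ,
     *-cancel-squares a b (+ R) s m≡aR² n≡bs² y≡Rs y≢0 mn≡Dy²
  where
  R = gcd ∣ m ∣ ∣ y ∣
  S = gcd ∣ n ∣ ∣ y ∣
  ∣mn∣≡∣D∣∣y∣² : ∣ m ∣ ℕ.* ∣ n ∣ ≡ ∣ D ∣ ℕ.* (∣ y ∣ ℕ.* ∣ y ∣)
  ∣mn∣≡∣D∣∣y∣² = begin
    ∣ m ∣ ℕ.* ∣ n ∣              ≡⟨ sym (abs-* m n) ⟩
    ∣ m * n ∣                    ≡⟨ cong ∣_∣ mn≡Dy² ⟩
    ∣ D * (y * y) ∣              ≡⟨ abs-* D (y * y) ⟩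
    ∣ D ∣ ℕ.* ∣ y * y ∣          ≡⟨ cong (∣ D ∣ ℕ.*_) (abs-* y y) ⟩
    ∣ D ∣ ℕ.* (∣ y ∣ ℕ.* ∣ y ∣)  ∎

SquareFree-1 : SquareFree (+ 1)
SquareFree-1 n n²∣1 = ℕ.m*n≡1⇒n≡1 ∣ n ∣ ∣ n ∣ (trans (sym (abs-* n n)) (ℕ.∣1⇒≡1 n²∣1))

SquareFree-neg : SquareFree d → SquareFree (- d)
SquareFree-neg {d} sf n n²∣-d = sf n (subst (∣ n * n ∣ ℕ.∣_) (∣-i∣≡∣i∣ d) n²∣-d)

SquareFree-factor : a * b ≡ d → SquareFree d → SquareFree a
SquareFree-factor {a} {b} refl sf n n²∣a =
  sf n (ℕ.∣-trans n²∣a (subst (∣ a ∣ ℕ.∣_) (sym (abs-* a b)) (ℕ.m∣m*n ∣ b ∣)))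

SquareFree-2* : SquareFree a → ¬ (+ 2 ∣ a) → SquareFree (+ 2 * a)
SquareFree-2* {a} sf 2∤a n n²∣2a with parity n
... | even m refl = ⊥-elim (2∤a (∣-*-cancelˡ (+ 2) {+ 2} {a} (ℕ.∣-trans 2·2∣n² n²∣2a)))
  where
  2·2∣n² : + 2 * + 2 ∣ (+ 2 * m) * (+ 2 * m)
  2·2∣n² = Signed.∣⇒∣ᵤ {+ 2 * + 2} {(+ 2 * m) * (+ 2 * m)} (Signed.divides (m * m) (solve (m ∷ [])))
... | odd m refl = sf n (coprime-divisor (n * n) (+ 2) a n²⊥2 n²∣2a)
  where
  n²⊥2 : Coprime (n * n) (+ 2)
  n²⊥2 = lincomb≡1⇒coprime (+ 1) (n * n) (- (+ 2 * m * m + + 2 * m)) (+ 2) (solve (m ∷ []))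

SquareFree⇒even : SquareFree d → d * (y * y) ≡ + 4 * t → ∃[ z ] y ≡ + 2 * z
SquareFree⇒even {d} {y} {t} sf dy²≡4t with parity y
... | even z y≡2z = z , y≡2z
... | odd j refl = contradiction (sf (+ 2) (Signed.∣⇒∣ᵤ {+ 2 * + 2} {d} (Signed.divides q d≡q·4))) λ ()
  where
  q = t - d * j * j - d * j
  d≡q·4 : d ≡ q * (+ 2 * + 2)
  d≡q·4 = begin
    d
      ≡⟨ solve (d ∷ j ∷ t ∷ []) ⟩
    d * ((+ 2 * j + + 1) * (+ 2 * j + + 1)) - + 4 * t + (t - d * j * j - d * j) * (+ 2 * + 2)
      ≡⟨ cong (λ w → w - + 4 * t + (t - d * j * j - d * j) * (+ 2 * + 2)) dy²≡4t ⟩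
    + 4 * t - + 4 * t + (t - d * j * j - d * j) * (+ 2 * + 2)
      ≡⟨ solve (t ∷ d ∷ j ∷ []) ⟩
    (t - d * j * j - d * j) * (+ 2 * + 2)
      ∎

ImageOfT : ℤ → ℤ → ℤ → Set
ImageOfT Δ x y = ∃[ a ] ∃[ b ] ∃[ r ] ∃[ s ]
  (a * b ≡ Δ × SquareFree a × a * (r * r) - b * (s * s) ≡ + 4 × x ≡ a * (r * r) - + 2 × y ≡ r * s)

Δy²≡x²-4 : x * x - Δ * (y * y) ≡ + 4 → Δ * (y * y) ≡ x * x - + 4
Δy²≡x²-4 {x} {Δ} {y} eq = begin
  Δ * (y * y)                    ≡⟨ solve (x ∷ Δ ∷ y ∷ []) ⟩
  x * x - (x * x - Δ * (y * y))  ≡⟨ cong (λ w → x * x - w) eq ⟩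
  x * x - + 4                    ∎

[x+2][x-2]≡Δy² : x * x - Δ * (y * y) ≡ + 4 → (x + + 2) * (x - + 2) ≡ Δ * (y * y)
[x+2][x-2]≡Δy² {x} {Δ} {y} eq = sym (trans (Δy²≡x²-4 {x} {Δ} {y} eq) (solve (x ∷ [])))

image-of-T : ∀ a b r s → x * x - Δ * (y * y) ≡ + 4 → y ≢ 0ℤ → SquareFree a →
             x + + 2 ≡ a * (r * r) → x - + 2 ≡ b * (s * s) → y ≡ r * s → ImageOfT Δ x y
image-of-T {x} {Δ} {y} a b r s eq y≢0 sf x+2≡ar² x-2≡bs² y≡rs =
  a , b , r , s ,
  *-cancel-squares a b r s x+2≡ar² x-2≡bs² y≡rs y≢0 ([x+2][x-2]≡Δy² {x} {Δ} {y} eq) ,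
  sf ,
  trans (sym (cong₂ _-_ x+2≡ar² x-2≡bs²)) (solve (x ∷ [])) ,
  sym (trans (cong (_- + 2) (sym x+2≡ar²)) (solve (x ∷ []))) ,
  y≡rs

odd±2-coprime : ∀ k → Coprime (+ 2 * k + + 1 + + 2) (+ 2 * k + + 1 - + 2)
odd±2-coprime k =
  lincomb≡1⇒coprime (+ 1 - k - k * k) (+ 2 * k + + 1 + + 2) (k * k + + 3 * k + + 2) (+ 2 * k + + 1 - + 2)
                    (solve (k ∷ []))

image-of-T-odd : SquareFree Δ → (+ 2 * k + + 1) * (+ 2 * k + + 1) - Δ * (y * y) ≡ + 4 → y ≢ 0ℤ →
                 ImageOfT Δ (+ 2 * k + + 1) y
image-of-T-odd {Δ} {k} {y} sf eq y≢0 =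
  let a , b , r , s , x+2≡ar² , x-2≡bs² , y≡rs , ab≡Δ =
        coprime-square-split {+ 2 * k + + 1 + + 2} {+ 2 * k + + 1 - + 2} {Δ} {y}
          (odd±2-coprime k) ([x+2][x-2]≡Δy² {+ 2 * k + + 1} {Δ} {y} eq) y≢0
  in image-of-T a b r s eq y≢0 (SquareFree-factor {a} {b} ab≡Δ sf) x+2≡ar² x-2≡bs² y≡rs

split-2[2P+1] : SquareFree d → + 4 * (P * (P + + 1)) ≡ d * (y * y) → y ≢ 0ℤ →
  ∃[ a ] ∃[ b ] ∃[ r ] ∃[ s ]
    (a * b ≡ d × + 2 * (+ 2 * P + + 1) + + 2 ≡ a * ((+ 2 * r) * (+ 2 * r))
               × + 2 * (+ 2 * P + + 1) - + 2 ≡ + 4 * (b * (s * s)) × y ≡ + 2 * (r * s))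
split-2[2P+1] {d} {P} {y} sf 4P[P+1]≡dy² y≢0
  with SquareFree⇒even {d} {y} {P * (P + + 1)} sf (sym 4P[P+1]≡dy²)
... | z , refl =
  let a , b , r , s , P+1≡ar² , P≡bs² , z≡rs , ab≡d =
        coprime-square-split {P + + 1} {P} {d} {z} P+1⊥P [P+1]P≡dz² (λ z≡0 → y≢0 (cong (+ 2 *_) z≡0))
  in a , b , r , s , ab≡d , x+2≡a[2r]² a r P+1≡ar² , x-2≡4bs² b s P≡bs² , cong (+ 2 *_) z≡rs
  where
  P+1⊥P : Coprime (P + + 1) P
  P+1⊥P = lincomb≡1⇒coprime (+ 1) (P + + 1) (- + 1) P (solve (P ∷ []))
  [P+1]P≡dz² : (P + + 1) * P ≡ d * (z * z)
  [P+1]P≡dz² = *-cancelˡ-≡ (+ 4) _ _ (begin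
    + 4 * ((P + + 1) * P)        ≡⟨ solve (P ∷ []) ⟩
    + 4 * (P * (P + + 1))        ≡⟨ 4P[P+1]≡dy² ⟩
    d * ((+ 2 * z) * (+ 2 * z))  ≡⟨ solve (d ∷ z ∷ []) ⟩
    + 4 * (d * (z * z))          ∎)
  x+2≡a[2r]² : ∀ a r → P + + 1 ≡ a * (r * r) → + 2 * (+ 2 * P + + 1) + + 2 ≡ a * ((+ 2 * r) * (+ 2 * r))
  x+2≡a[2r]² a r P+1≡ar² = begin
    + 2 * (+ 2 * P + + 1) + + 2  ≡⟨ solve (P ∷ []) ⟩
    + 4 * (P + + 1)              ≡⟨ cong (+ 4 *_) P+1≡ar² ⟩
    + 4 * (a * (r * r))          ≡⟨ solve (a ∷ r ∷ []) ⟩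
    a * ((+ 2 * r) * (+ 2 * r))  ∎
  x-2≡4bs² : ∀ b s → P ≡ b * (s * s) → + 2 * (+ 2 * P + + 1) - + 2 ≡ + 4 * (b * (s * s))
  x-2≡4bs² b s P≡bs² = begin
    + 2 * (+ 2 * P + + 1) - + 2  ≡⟨ solve (P ∷ []) ⟩
    + 4 * P                      ≡⟨ cong (+ 4 *_) P≡bs² ⟩
    + 4 * (b * (s * s))          ∎

image-of-T-2[2P+1] : SquareFree d →
  (+ 2 * (+ 2 * P + + 1)) * (+ 2 * (+ 2 * P + + 1)) - d * (y * y) ≡ + 4 → y ≢ 0ℤ →
  ImageOfT d (+ 2 * (+ 2 * P + + 1)) y
image-of-T-2[2P+1] {d} {P} {y} sf eq y≢0 =
  let Y , y≡2Y = SquareFree⇒even {d} {y} {+ 4 * (P * (P + + 1))} sf dy²≡4·4P[P+1]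
      a , b , r , s , ab≡d , x+2≡a[2r]² , x-2≡4bs² , Y≡2rs =
        split-2[2P+1] {d} {P} {Y} sf (4P[P+1]≡dY² {Y} y≡2Y)
          (λ Y≡0 → y≢0 (trans y≡2Y (cong (+ 2 *_) Y≡0)))
  in image-of-T a b (+ 2 * r) (+ 2 * s) eq y≢0 (SquareFree-factor {a} {b} ab≡d sf) x+2≡a[2r]²
       (trans x-2≡4bs² (4bs²≡b[2s]² b s))
       (trans y≡2Y (trans (cong (+ 2 *_) Y≡2rs) (2[2rs]≡[2r][2s] r s)))
  where
  4bs²≡b[2s]² : ∀ b s → + 4 * (b * (s * s)) ≡ b * ((+ 2 * s) * (+ 2 * s))
  4bs²≡b[2s]² b s = solve (b ∷ s ∷ [])
  2[2rs]≡[2r][2s] : ∀ r s → + 2 * (+ 2 * (r * s)) ≡ (+ 2 * r) * (+ 2 * s)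
  2[2rs]≡[2r][2s] r s = solve (r ∷ s ∷ [])
  dy²≡4·4P[P+1] : d * (y * y) ≡ + 4 * (+ 4 * (P * (P + + 1)))
  dy²≡4·4P[P+1] = trans (Δy²≡x²-4 {+ 2 * (+ 2 * P + + 1)} {d} {y} eq) (solve (P ∷ []))
  4P[P+1]≡dY² : ∀ {Y} → y ≡ + 2 * Y → + 4 * (P * (P + + 1)) ≡ d * (Y * Y)
  4P[P+1]≡dY² {Y} y≡2Y = *-cancelˡ-≡ (+ 4) _ _ (begin
    + 4 * (+ 4 * (P * (P + + 1)))  ≡⟨ sym dy²≡4·4P[P+1] ⟩
    d * (y * y)                    ≡⟨ cong (λ w → d * (w * w)) y≡2Y ⟩
    d * ((+ 2 * Y) * (+ 2 * Y))    ≡⟨ solve (d ∷ Y ∷ []) ⟩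
    + 4 * (d * (Y * Y))            ∎)

image-of-T-4d-2[2P+1] : SquareFree d →
  (+ 2 * (+ 2 * P + + 1)) * (+ 2 * (+ 2 * P + + 1)) - (+ 4 * d) * (y * y) ≡ + 4 → y ≢ 0ℤ →
  ImageOfT (+ 4 * d) (+ 2 * (+ 2 * P + + 1)) y
image-of-T-4d-2[2P+1] {d} {P} {y} sf eq y≢0 =
  let a , b , r , s , ab≡d , x+2≡a[2r]² , x-2≡4bs² , y≡2rs =
        split-2[2P+1] {d} {P} {y} sf 4P[P+1]≡dy² y≢0
  in image-of-T a (+ 4 * b) (+ 2 * r) s eq y≢0 (SquareFree-factor {a} {b} ab≡d sf) x+2≡a[2r]²
       (trans x-2≡4bs² (sym (*-assoc (+ 4) b (s * s)))) (trans y≡2rs (sym (*-assoc (+ 2) r s)))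
  where
  4P[P+1]≡dy² : + 4 * (P * (P + + 1)) ≡ d * (y * y)
  4P[P+1]≡dy² = *-cancelˡ-≡ (+ 4) _ _ (begin
    + 4 * (+ 4 * (P * (P + + 1)))                            ≡⟨ solve (P ∷ []) ⟩
    (+ 2 * (+ 2 * P + + 1)) * (+ 2 * (+ 2 * P + + 1)) - + 4
      ≡⟨ sym (Δy²≡x²-4 {+ 2 * (+ 2 * P + + 1)} {+ 4 * d} {y} eq) ⟩
    (+ 4 * d) * (y * y)                                      ≡⟨ solve (d ∷ y ∷ []) ⟩
    + 4 * (d * (y * y))                                      ∎)

image-of-T-4d-4U : SquareFree d →
                   (+ 2 * (+ 2 * U)) * (+ 2 * (+ 2 * U)) - (+ 4 * d) * (y * y) ≡ + 4 → y ≢ 0ℤ →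
                   ImageOfT (+ 4 * d) (+ 2 * (+ 2 * U)) y
image-of-T-4d-4U {d} {U} {y} sf eq y≢0 =
  let a , b , r , s , 2U+1≡ar² , 2U-1≡bs² , y≡rs , ab≡d =
        coprime-square-split {+ 2 * U + + 1} {+ 2 * U - + 1} {d} {y} 2U+1⊥2U-1 [2U+1][2U-1]≡dy² y≢0
  in image-of-T (+ 2 * a) (+ 2 * b) r s eq y≢0
       (SquareFree-2* {a} (SquareFree-factor {a} {b} ab≡d sf) (2∤factor-of-odd {a} {r * r} {U} (sym 2U+1≡ar²)))
       (x+2≡2ar² a r 2U+1≡ar²) (x-2≡2bs² b s 2U-1≡bs²) y≡rs
  where
  2U+1⊥2U-1 : Coprime (+ 2 * U + + 1) (+ 2 * U - + 1)
  2U+1⊥2U-1 = lincomb≡1⇒coprime (+ 1 - + 2 * U * U) (+ 2 * U + + 1) (+ 2 * U * U + + 2 * U) (+ 2 * U - + 1)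
                                (solve (U ∷ []))
  [2U+1][2U-1]≡dy² : (+ 2 * U + + 1) * (+ 2 * U - + 1) ≡ d * (y * y)
  [2U+1][2U-1]≡dy² = *-cancelˡ-≡ (+ 4) _ _ (begin
    + 4 * ((+ 2 * U + + 1) * (+ 2 * U - + 1))    ≡⟨ solve (U ∷ []) ⟩
    (+ 2 * (+ 2 * U)) * (+ 2 * (+ 2 * U)) - + 4  ≡⟨ sym (Δy²≡x²-4 {+ 2 * (+ 2 * U)} {+ 4 * d} {y} eq) ⟩
    (+ 4 * d) * (y * y)                          ≡⟨ solve (d ∷ y ∷ []) ⟩
    + 4 * (d * (y * y))                          ∎)
  x+2≡2ar² : ∀ a r → + 2 * U + + 1 ≡ a * (r * r) → + 2 * (+ 2 * U) + + 2 ≡ (+ 2 * a) * (r * r)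
  x+2≡2ar² a r 2U+1≡ar² = begin
    + 2 * (+ 2 * U) + + 2  ≡⟨ solve (U ∷ []) ⟩
    + 2 * (+ 2 * U + + 1)  ≡⟨ cong (+ 2 *_) 2U+1≡ar² ⟩
    + 2 * (a * (r * r))    ≡⟨ solve (a ∷ r ∷ []) ⟩
    (+ 2 * a) * (r * r)    ∎
  x-2≡2bs² : ∀ b s → + 2 * U - + 1 ≡ b * (s * s) → + 2 * (+ 2 * U) - + 2 ≡ (+ 2 * b) * (s * s)
  x-2≡2bs² b s 2U-1≡bs² = begin
    + 2 * (+ 2 * U) - + 2  ≡⟨ solve (U ∷ []) ⟩
    + 2 * (+ 2 * U - + 1)  ≡⟨ cong (+ 2 *_) 2U-1≡bs² ⟩
    + 2 * (b * (s * s))    ≡⟨ solve (b ∷ s ∷ []) ⟩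
    (+ 2 * b) * (s * s)    ∎

odd²-4dy²≢4 : (+ 2 * k + + 1) * (+ 2 * k + + 1) - (+ 4 * d) * (y * y) ≢ + 4
odd²-4dy²≢4 {k} {d} {y} eq = k*t≢c 4 (λ ()) (k * k + k - d * (y * y)) (begin
  + 4 * (k * k + k - d * (y * y))                                ≡⟨ solve (k ∷ d ∷ y ∷ []) ⟩
  (+ 2 * k + + 1) * (+ 2 * k + + 1) - (+ 4 * d) * (y * y) - + 1  ≡⟨ cong (_- + 1) eq ⟩
  + 3                                                            ∎)

[4U]²-dy²≢4 : d ≡ + 4 * k + + 1 → (+ 2 * (+ 2 * U)) * (+ 2 * (+ 2 * U)) - d * (y * y) ≢ + 4
[4U]²-dy²≢4 {k = k} {U} {y} refl eq with parity y
... | odd V refl = k*t≢c 4 (λ ()) (+ 4 * U * U - k * (+ 4 * V * V + + 4 * V + + 1) - V * V - V) (begin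
  + 4 * (+ 4 * U * U - k * (+ 4 * V * V + + 4 * V + + 1) - V * V - V)
    ≡⟨ solve (U ∷ k ∷ V ∷ []) ⟩
  (+ 2 * (+ 2 * U)) * (+ 2 * (+ 2 * U)) - (+ 4 * k + + 1) * ((+ 2 * V + + 1) * (+ 2 * V + + 1)) + + 1
    ≡⟨ cong (_+ + 1) eq ⟩
  + 5
    ∎)
... | even V refl with parity V
...   | even W refl = k*t≢c 16 (λ ()) (U * U - (+ 4 * k + + 1) * (W * W)) (begin
  + 16 * (U * U - (+ 4 * k + + 1) * (W * W))
    ≡⟨ solve (U ∷ k ∷ W ∷ []) ⟩
  (+ 2 * (+ 2 * U)) * (+ 2 * (+ 2 * U)) - (+ 4 * k + + 1) * ((+ 2 * (+ 2 * W)) * (+ 2 * (+ 2 * W)))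
    ≡⟨ eq ⟩
  + 4
    ∎)
...   | odd W refl = k*t≢c 16 (λ ()) (U * U - (+ 4 * k + + 1) * (W * W + W) - k) (begin
  + 16 * (U * U - (+ 4 * k + + 1) * (W * W + W) - k)
    ≡⟨ solve (U ∷ k ∷ W ∷ []) ⟩
  (+ 2 * (+ 2 * U)) * (+ 2 * (+ 2 * U)) - (+ 4 * k + + 1) * ((+ 2 * (+ 2 * W + + 1)) * (+ 2 * (+ 2 * W + + 1))) + + 4
    ≡⟨ cong (_+ + 4) eq ⟩
  + 8
    ∎)

image-of-T-≡1-mod-4 : SquareFree d → d ≡ + 4 * k + + 1 →
                      ∀ x y → x * x - d * (y * y) ≡ + 4 → y ≢ 0ℤ → ImageOfT d x y
image-of-T-≡1-mod-4 {d} {k} sf d≡4k+1 x y eq y≢0 with parity x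
... | odd j refl = image-of-T-odd {d} {j} {y} sf eq y≢0
... | even X refl with parity X
...   | even U refl = ⊥-elim ([4U]²-dy²≢4 {d} {k} {U} {y} d≡4k+1 eq)
...   | odd P refl = image-of-T-2[2P+1] {d} {P} {y} sf eq y≢0

image-of-T-4d : SquareFree d →
                ∀ x y → x * x - (+ 4 * d) * (y * y) ≡ + 4 → y ≢ 0ℤ → ImageOfT (+ 4 * d) x y
image-of-T-4d {d} sf x y eq y≢0 with parity x
... | odd j refl = ⊥-elim (odd²-4dy²≢4 {j} {d} {y} eq)
... | even X refl with parity X
...   | even U refl = image-of-T-4d-4U {d} {U} {y} sf eq y≢0
...   | odd P refl = image-of-T-4d-2[2P+1] {d} {P} {y} sf eq y≢0

data Disc (d : ℤ) : ℤ → Set where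
  ≡1-mod-4  : ∀ k → d ≡ + 4 * k + + 1 → Disc d d
  otherwise : Disc d (+ 4 * d)

disc-view : ∀ d → Disc d (disc d)
disc-view d with d %ℕ 4 | a≡a%ℕn+[a/ℕn]*n d 4
... | 0 | _ = otherwise
... | 1 | d≡ = ≡1-mod-4 q (trans d≡ (trans (+-comm (+ 1) (q * + 4)) (cong (_+ + 1) (*-comm q (+ 4)))))
  where q = d /ℕ 4
... | ℕ.suc (ℕ.suc _) | _ = otherwise

n*n≡4⇒n≡2 : ∀ {n} → n ℕ.* n ≡ 4 → n ≡ 2
n*n≡4⇒n≡2 {0} ()
n*n≡4⇒n≡2 {1} ()
n*n≡4⇒n≡2 {2} _ = refl
n*n≡4⇒n≡2 {3} ()
n*n≡4⇒n≡2 {4} ()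
n*n≡4⇒n≡2 {ℕ.suc (ℕ.suc (ℕ.suc (ℕ.suc (ℕ.suc _))))} ()

x²≡4⇒x≡±2 : x * x ≡ + 4 → x ≡ + 2 ⊎ x ≡ - + 2
x²≡4⇒x≡±2 {x} x²≡4 with +∣i∣≡i⊎+∣i∣≡-i x
... | inj₁ +∣x∣≡x  = inj₁ (trans (sym +∣x∣≡x) +∣x∣≡2)
  where +∣x∣≡2 = cong +_ (n*n≡4⇒n≡2 (trans (sym (abs-* x x)) (cong ∣_∣ x²≡4)))
... | inj₂ +∣x∣≡-x = inj₂ (trans (sym (neg-involutive x)) (cong -_ (trans (sym +∣x∣≡-x) +∣x∣≡2)))
  where +∣x∣≡2 = cong +_ (n*n≡4⇒n≡2 (trans (sym (abs-* x x)) (cong ∣_∣ x²≡4)))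

image-of-T-±2 : SquareFree d → Disc d Δ → x ≡ + 2 ⊎ x ≡ - + 2 → ImageOfT Δ x (+ 0)
image-of-T-±2 {Δ = Δ} sf _ (inj₁ refl) =
  + 1 , Δ , + 2 , + 0 , *-identityˡ Δ , SquareFree-1 , solve (Δ ∷ []) , refl , refl
image-of-T-±2 {d} sf (≡1-mod-4 _ _) (inj₂ refl) =
  - d , - + 1 , + 0 , + 2 , solve (d ∷ []) , SquareFree-neg {d} sf , solve (d ∷ []) , solve (d ∷ []) , refl
image-of-T-±2 {d} sf otherwise (inj₂ refl) =
  - d , - + 4 , + 0 , + 1 , solve (d ∷ []) , SquareFree-neg {d} sf , solve (d ∷ []) , solve (d ∷ []) , refl

image-of-T-disc : SquareFree d → Disc d Δ → ∀ x y → x * x - Δ * (y * y) ≡ + 4 → ImageOfT Δ x y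
image-of-T-disc {Δ = Δ} sf view x y eq with y ≟ 0ℤ
... | yes refl = image-of-T-±2 sf view (x²≡4⇒x≡±2 (begin
  x * x                    ≡⟨ solve (x ∷ Δ ∷ []) ⟩
  x * x - Δ * (+ 0 * + 0)  ≡⟨ eq ⟩
  + 4                      ∎))
image-of-T-disc sf (≡1-mod-4 k d≡4k+1) x y eq | no y≢0 = image-of-T-≡1-mod-4 {k = k} sf d≡4k+1 x y eq y≢0
image-of-T-disc sf otherwise           x y eq | no y≢0 = image-of-T-4d sf x y eq y≢0

T-solution⇒solution : ∀ a b r s → a * b ≡ Δ → a * (r * r) - b * (s * s) ≡ + 4 →
  (a * (r * r) - + 2) * (a * (r * r) - + 2) - Δ * ((r * s) * (r * s)) ≡ + 4
T-solution⇒solution a b r s refl eq = begin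
  (a * (r * r) - + 2) * (a * (r * r) - + 2) - a * b * ((r * s) * (r * s))
    ≡⟨ solve (a ∷ b ∷ r ∷ s ∷ []) ⟩
  a * (r * r) * (a * (r * r) - b * (s * s)) - + 4 * (a * (r * r)) + + 4
    ≡⟨ cong (λ w → a * (r * r) * w - + 4 * (a * (r * r)) + + 4) eq ⟩
  a * (r * r) * + 4 - + 4 * (a * (r * r)) + + 4
    ≡⟨ solve (a ∷ r ∷ []) ⟩
  + 4
    ∎

theorem3p1 : ∀ (d : ℤ) → SquareFree d → d ≢ + 1 →
    (∀ (x y : ℤ) → x * x - disc d * (y * y) ≡ + 4 →
      ∃[ a ] ∃[ b ] ∃[ r ] ∃[ s ]
        (a * b ≡ disc d × SquareFree a × a * (r * r) - b * (s * s) ≡ + 4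
          × x ≡ a * (r * r) - + 2 × y ≡ r * s))
    × (∀ (a b r s : ℤ) → a * b ≡ disc d → a * (r * r) - b * (s * s) ≡ + 4 →
      (a * (r * r) - + 2) * (a * (r * r) - + 2) - disc d * ((r * s) * (r * s)) ≡ + 4)
theorem3p1 d sf _ = image-of-T-disc sf (disc-view d) , T-solution⇒solution
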